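{- Let $T=(\mathcal{L},\mathcal{R})$ be a graph transformation system and $D\subseteq\mathcal{G}(\mathcal{L})$. Then $T$ has only finitely many non-garbage critical pairs with respect to $D$, up to isomorphism. If $\overline{D}$ is decidable, then one can find all the non-garbage critical pairs in finite time.
   Context: Fix a label alphabet $\mathcal{L}=(\mathcal{L}_V,\mathcal{L}_E)$ of finite sets. A graph is $G=(V,E,s,t,l,m)$ with finite $V,E$, total $s,t$, total labellings $l:V\to\mathcal{L}_V$, $m:E\to\mathcal{L}_E$; morphisms preserve sources, targets, labels. A rule $r=\langle L\leftarrow K\rightarrow R\rangle$: graphs with $K$ a subgraph of $L$ and $R$. A direct derivation $G\Rightarrow_{r,g}H$ uses an injective $g:L\to G$ satisfying the dangling condition (no edge outside $g(L)$ incident to $g(V_L\setminus V_K)$), deletes $g(L\setminus K)$ and adds $R\setminus K$ glued along $K$ (double pushout). GT system $T=(\mathcal{L},\mathcal{R})$: finite rule set. $\mathcal{G}(\mathcal{L})$: isomorphism classes of graphs. Two direct derivations $H_1\Leftarrow_{r_1,g_1}G\Rightarrow_{r_2,g_2}H_2$ are parallelly independent iff $g_1(L_1)\cap g_2(L_2)\subseteq g_1(K_1)\cap g_2(K_2)$. They form a critical pair iff $G=g_1(L_1)\cup g_2(L_2)$, they are not parallelly independent, and $g_1\ne g_2$ if $r_1=r_2$. $D\subseteq\mathcal{G}(\mathcal{L})$ is subgraph closed iff $[G]\in D$ and $H$ a subgraph of $G$ imply $[H]\in D$; $\overline{D}$ (the subgraph closure) is the smallest subgraph-closed set containing $D$.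 A critical pair $H_1\Leftarrow G\Rightarrow H_2$ is non-garbage (w.r.t. $D$) iff $[G]\in\overline{D}$. -}

module Defs where

open import Data.Nat using (ℕ)
open import Data.Fin using (Fin)
open import Data.Product using (Σ; ∃; _×_; _,_)
open import Data.Sum using (_⊎_)
open import Data.List using (List)
open import Data.List.Relation.Unary.All using (All)
open import Data.List.Relation.Unary.Any using (Any)
open import Relation.Binary.PropositionalEquality using (_≡_; _≢_; subst)
open import Relation.Nullary using (¬_)
open import Function.Definitions using (Injective)

-- Label alphabet: L_V = Fin kV, L_E = Fin kE (finite sets)

record Alphabet : Set where
  field
    kV kE : ℕ
open Alphabet

record Graph (A : Alphabet) : Set where
  field
    nV nE : ℕ
    src tgt : Fin nE → Fin nV
    lV : Fin nV → Fin (kV A)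
    lE : Fin nE → Fin (kE A)
open Graph public

module _ {A : Alphabet} where

  record Hom (G H : Graph A) : Set where
    field
      fV : Fin (nV G) → Fin (nV H)
      fE : Fin (nE G) → Fin (nE H)
      pres-src : ∀ e → src H (fE e) ≡ fV (src G e)
      pres-tgt : ∀ e → tgt H (fE e) ≡ fV (tgt G e)
      pres-lV  : ∀ v → lV H (fV v) ≡ lV G v
      pres-lE  : ∀ e → lE H (fE e) ≡ lE G e
  open Hom public

  _≈ₕ_ : {G H : Graph A} → Hom G H → Hom G H → Set
  f ≈ₕ g = (∀ v → fV f v ≡ fV g v) × (∀ e → fE f e ≡ fE g e)

  idₕ : (G : Graph A) → Hom G G
  idₕ G = record
    { fV = λ v → v ; fE = λ e → e
    ; pres-src = λ _ → _≡_.refl ; pres-tgt = λ _ → _≡_.refl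
    ; pres-lV = λ _ → _≡_.refl ; pres-lE = λ _ → _≡_.refl }

  _∘ₕ_ : {G H K : Graph A} → Hom H K → Hom G H → Hom G K
  _∘ₕ_ {G} {H} {K} g f = record
    { fV = λ v → fV g (fV f v)
    ; fE = λ e → fE g (fE f e)
    ; pres-src = λ e → trans (pres-src g (fE f e)) (cong (fV g) (pres-src f e))
    ; pres-tgt = λ e → trans (pres-tgt g (fE f e)) (cong (fV g) (pres-tgt f e))
    ; pres-lV = λ v → trans (pres-lV g (fV f v)) (pres-lV f v)
    ; pres-lE = λ e → trans (pres-lE g (fE f e)) (pres-lE f e) }
    where open import Relation.Binary.PropositionalEquality using (trans; cong)

  IsInjective : {G H : Graph A} → Hom G H → Set
  IsInjective f = Injective _≡_ _≡_ (fV f) × Injective _≡_ _≡_ (fE f)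

  record Iso (G H : Graph A) : Set where
    field
      to   : Hom G H
      from : Hom H G
      from∘to : (from ∘ₕ to) ≈ₕ idₕ G
      to∘from : (to ∘ₕ from) ≈ₕ idₕ H
  open Iso public

  -- "H is a subgraph of G" (up to isomorphism): an injective morphism H → G
  SubgraphOf : Graph A → Graph A → Set
  SubgraphOf H G = Σ (Hom H G) IsInjective

  InImV : {G H : Graph A} → Hom G H → Fin (nV H) → Set
  InImV f v = ∃ λ w → fV f w ≡ v

  InImE : {G H : Graph A} → Hom G H → Fin (nE H) → Set
  InImE f e = ∃ λ d → fE f d ≡ e

  -- pushout squares (universal property in the category of graphs)
  --      b
  --   X0 → X1
  -- c ↓     ↓ b'
  --   X2 → P
  --      c'
  IsPushout : {X0 X1 X2 P : Graph A} →
              Hom X0 X1 → Hom X0 X2 → Hom X1 P → Hom X2 P → Set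
  IsPushout {X0} {X1} {X2} {P} b c b' c' =
    ((b' ∘ₕ b) ≈ₕ (c' ∘ₕ c)) ×
    (∀ (Y : Graph A) (y1 : Hom X1 Y) (y2 : Hom X2 Y) →
       (y1 ∘ₕ b) ≈ₕ (y2 ∘ₕ c) →
       Σ (Hom P Y) λ u → ((u ∘ₕ b') ≈ₕ y1) × ((u ∘ₕ c') ≈ₕ y2) ×
         (∀ (u' : Hom P Y) → (u' ∘ₕ b') ≈ₕ y1 → (u' ∘ₕ c') ≈ₕ y2 → u' ≈ₕ u))

  record Rule : Set where
    field
      L K R : Graph A
      kl : Hom K L
      kr : Hom K R
      kl-inj : IsInjective kl
      kr-inj : IsInjective kr
  open Rule public

  Dangling : (r : Rule) {G : Graph A} → Hom (L r) G → Set
  Dangling r {G} g =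
    ∀ (e : Fin (nE G)) → ¬ InImE g e →
    ∀ (v : Fin (nV (L r))) → ¬ InImV (kl r) v →
    (src G e ≢ fV g v) × (tgt G e ≢ fV g v)

  record Derivation (r : Rule) {G : Graph A} (g : Hom (L r) G) (H : Graph A) : Set where
    field
      g-inj    : IsInjective g
      dangling : Dangling r g
      D        : Graph A
      k        : Hom (K r) D
      d        : Hom D G
      h        : Hom (R r) H
      e        : Hom D H
      pushoutL : IsPushout (kl r) k g d
      pushoutR : IsPushout k (kr r) e h

  record GTS : Set where
    field
      nR    : ℕ
      rules : Fin nR → Rule
  open GTS public

  module _ (T : GTS) where

    record DerivPair : Set where
      field
        G     : Graph A
        i1 i2 : Fin (nR T)
        g1    : Hom (L (rules T i1)) G
        g2    : Hom (L (rules T i2)) G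
        H1 H2 : Graph A
        der1  : Derivation (rules T i1) g1 H1
        der2  : Derivation (rules T i2) g2 H2

    module _ (p : DerivPair) where
      open DerivPair p

      ParallelIndependent : Set
      ParallelIndependent =
        (∀ v → InImV g1 v → InImV g2 v →
           InImV (g1 ∘ₕ kl (rules T i1)) v × InImV (g2 ∘ₕ kl (rules T i2)) v) ×
        (∀ e → InImE g1 e → InImE g2 e →
           InImE (g1 ∘ₕ kl (rules T i1)) e × InImE (g2 ∘ₕ kl (rules T i2)) e)

      JointlyCovering : Set
      JointlyCovering =
        (∀ v → InImV g1 v ⊎ InImV g2 v) × (∀ e → InImE g1 e ⊎ InImE g2 e)

      DistinctIfSameRule : Set
      DistinctIfSameRule =
        (eq : i1 ≡ i2) → ¬ (subst (λ i → Hom (L (rules T i)) G) eq g1 ≈ₕ g2)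

      IsCriticalPair : Set
      IsCriticalPair = JointlyCovering × ¬ ParallelIndependent × DistinctIfSameRule

    IsoPair : DerivPair → DerivPair → Set
    IsoPair p q =
      Σ (Iso (DerivPair.G p) (DerivPair.G q)) λ φ →
      Σ (DerivPair.i1 p ≡ DerivPair.i1 q) λ e1 →
      Σ (DerivPair.i2 p ≡ DerivPair.i2 q) λ e2 →
        (subst (λ i → Hom (L (rules T i)) (DerivPair.G q)) e1 (to φ ∘ₕ DerivPair.g1 p)
           ≈ₕ DerivPair.g1 q) ×
        (subst (λ i → Hom (L (rules T i)) (DerivPair.G q)) e2 (to φ ∘ₕ DerivPair.g2 p)
           ≈ₕ DerivPair.g2 q)

  data Closure (D : Graph A → Set) : Graph A → Set where
    base : ∀ {G} → D G → Closure D G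
    sub  : ∀ {G H} → Closure D G → SubgraphOf H G → Closure D H

  NonGarbageCP : (T : GTS) (D : Graph A → Set) → DerivPair T → Set
  NonGarbageCP T D p = IsCriticalPair T p × Closure D (DerivPair.G p)

  EnumeratesUpToIso : (T : GTS) → (DerivPair T → Set) → List (DerivPair T) → Set
  EnumeratesUpToIso T P xs =
    All P xs × (∀ p → P p → Any (IsoPair T p) xs)

module Submission where

-- A critical pair H1 ⇐ G ⇒ H2 is jointly covered by the images of the two
-- left-hand sides, so G has at most |L1| + |L2| nodes and at most as many edges.
-- Up to isomorphism its graph therefore lives on Fin nv and Fin ne for bounded
-- nv, ne, and such data (a graph structure and two matches, i.e. tuples of maps
-- between finite sets) can be listed exhaustively.  Each listed pair of
-- applicable matches is completed to a pair of direct derivations by an explicit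
-- double-pushout construction, and the critical ones are kept, criticality being
-- decidable and invariant under isomorphism.  The non-garbage pairs are then
-- selected from this finite list: by deciding the subgraph closure when that is
-- possible, and in general under a double negation, since excluded middle for
-- finitely many propositions is irrefutable.  Selection is complete because the
-- subgraph closure is invariant under isomorphism.

open import Defs
open import Data.Nat using (ℕ; zero; suc; _+_; _≤_; _<_; s≤s)
open import Data.Fin using (Fin; zero; suc; _↑ˡ_; _↑ʳ_; splitAt; join)
open import Data.Fin.Properties
  using (_≟_; any?; all?; suc-injective; ↑ˡ-injective; ↑ʳ-injective; injective⇒≤;
         splitAt-↑ˡ; splitAt-↑ʳ; splitAt⁻¹-↑ˡ; splitAt⁻¹-↑ʳ; splitAt-join)
open import Data.List using (List; []; _∷_; allFin; upTo; concatMap; filter)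
open import Data.List.Relation.Unary.All as All using (All; []; _∷_)
open import Data.List.Relation.Unary.Any as Any using (Any; here; there)
import Data.List.Relation.Unary.All.Properties as All
import Data.List.Relation.Unary.Any.Properties as Any
import Data.Vec.Functional as Vector
open import Data.List.Membership.Propositional using (_∈_)
open import Data.List.Membership.Propositional.Properties using (∈-allFin; ∈-upTo⁺)
open import Data.Product using (Σ; ∃; _×_; _,_; proj₁; proj₂)
import Data.Product
open import Data.Sum using (_⊎_; inj₁; inj₂; [_,_])
import Data.Sum
open import Data.Empty using (⊥-elim)
open import Relation.Nullary using (¬_; Dec; yes; no)
open import Relation.Nullary.Decidable using (¬?; _×-dec_; _⊎-dec_; _→-dec_; map′; ¬¬-excluded-middle)
open import Relation.Binary.PropositionalEquality hiding ([_])
open import Function.Definitions using (Injective)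
import Axiom.UniquenessOfIdentityProofs as UIP
open import Effect.Monad using (RawMonad)
import Data.List.Effectful
open import Level using (0ℓ)
open RawMonad (Data.List.Effectful.monad {0ℓ}) using (_>>=_)

Fiber : {X Y : Set} → (X → Y) → Y → Set
Fiber f y = ∃ λ x → f x ≡ y

fiber? : ∀ {n m} (f : Fin n → Fin m) → ∀ y → Dec (Fiber f y)
fiber? f y = any? (λ x → f x ≟ y)

injective? : ∀ {n m} (f : Fin n → Fin m) → Dec (Injective _≡_ _≡_ f)
injective? f = map′ (λ h {x} {y} → h x y) (λ h x y → h {x} {y})
  (all? λ x → all? λ y → (f x ≟ f y) →-dec (x ≟ y))

-- If the images of Fin a and Fin b jointly cover Fin n, then n ≤ a + b:
-- a choice of preimages is an injection Fin n → Fin a ⊎ Fin b ≅ Fin (a + b).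
covered⇒≤ : ∀ {a b n} (f : Fin a → Fin n) (g : Fin b → Fin n) →
            (∀ y → Fiber f y ⊎ Fiber g y) → n ≤ a + b
covered⇒≤ {a} {b} f g cover = injective⇒≤ {f = λ y → join a b (choose (cover y))} inj
  where
  choose : ∀ {y} → Fiber f y ⊎ Fiber g y → Fin a ⊎ Fin b
  choose (inj₁ (x , _)) = inj₁ x
  choose (inj₂ (x , _)) = inj₂ x

  unchoose : ∀ {y} (c : Fiber f y ⊎ Fiber g y) → [ f , g ] (choose c) ≡ y
  unchoose (inj₁ (_ , eq)) = eq
  unchoose (inj₂ (_ , eq)) = eq

  inj : Injective _≡_ _≡_ (λ y → join a b (choose (cover y)))
  inj {y} {y'} eq = begin
    y                                  ≡⟨ sym (unchoose (cover y)) ⟩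
    [ f , g ] (choose (cover y))       ≡⟨ cong [ f , g ] choice-eq ⟩
    [ f , g ] (choose (cover y'))      ≡⟨ unchoose (cover y') ⟩
    y'                                 ∎
    where
    open ≡-Reasoning
    choice-eq : choose (cover y) ≡ choose (cover y')
    choice-eq = trans (sym (splitAt-join a b _)) (trans (cong (splitAt a) eq) (splitAt-join a b _))

-- A decidable subset of Fin n, re-indexed as Fin size: an injective enumeration
-- `emb` of exactly the elements satisfying P, with an inverse `index` on them.
record FinSubset (n : ℕ) (P : Fin n → Set) : Set where
  field
    size      : ℕ
    emb       : Fin size → Fin n
    emb-P     : ∀ i → P (emb i)
    emb-inj   : Injective _≡_ _≡_ emb
    index     : ∀ v → P v → Fin size
    emb-index : ∀ v p → emb (index v p) ≡ v

  index-emb : ∀ i p → index (emb i) p ≡ i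
  index-emb i p = emb-inj (emb-index (emb i) p)

  index-cong : ∀ {v w} → v ≡ w → ∀ p q → index v p ≡ index w q
  index-cong {v} refl p q = emb-inj (trans (emb-index v p) (sym (emb-index v q)))

finSubset : ∀ n (P : Fin n → Set) → (∀ v → Dec (P v)) → FinSubset n P
finSubset zero P P? = record
  { size = zero ; emb = λ () ; emb-P = λ () ; emb-inj = λ {} ; index = λ () ; emb-index = λ () }
finSubset (suc n) P P? with finSubset n (λ v → P (suc v)) (λ v → P? (suc v)) | P? zero
... | S | yes p0 = record
  { size = suc size ; emb = emb′ ; emb-P = emb′-P ; emb-inj = emb′-inj
  ; index = index′ ; emb-index = emb-index′ }
  where
  open FinSubset S
  emb′ : Fin (suc size) → Fin (suc n)
  emb′ zero    = zero
  emb′ (suc i) = suc (emb i)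
  emb′-P : ∀ i → P (emb′ i)
  emb′-P zero    = p0
  emb′-P (suc i) = emb-P i
  emb′-inj : Injective _≡_ _≡_ emb′
  emb′-inj {zero}  {zero}  _  = refl
  emb′-inj {suc i} {suc j} eq = cong suc (emb-inj (suc-injective eq))
  index′ : ∀ v → P v → Fin (suc size)
  index′ zero    _ = zero
  index′ (suc v) p = suc (index v p)
  emb-index′ : ∀ v p → emb′ (index′ v p) ≡ v
  emb-index′ zero    _ = refl
  emb-index′ (suc v) p = cong suc (emb-index v p)
... | S | no ¬p0 = record
  { size = size ; emb = λ i → suc (emb i) ; emb-P = emb-P
  ; emb-inj = λ eq → emb-inj (suc-injective eq) ; index = index′ ; emb-index = emb-index′ }
  where
  open FinSubset S
  index′ : ∀ v → P v → Fin size
  index′ zero    p = ⊥-elim (¬p0 p)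
  index′ (suc v) p = index v p
  emb-index′ : ∀ v p → suc (emb (index′ v p)) ≡ v
  emb-index′ zero    p = ⊥-elim (¬p0 p)
  emb-index′ (suc v) p = cong suc (emb-index v p)

module SetPushout {X0 X1 X2 P : Set}
  (b : X0 → X1) (c : X0 → X2) (b' : X1 → P) (c' : X2 → P)
  (b'-inj : Injective _≡_ _≡_ b') (c'-inj : Injective _≡_ _≡_ c')
  (cover : ∀ p → Fiber b' p ⊎ Fiber c' p)
  (meet : ∀ x y → b' x ≡ c' y → ∃ λ z → b z ≡ x × c z ≡ y) where

  cover-elim : (Q : P → Set) → (∀ x → Q (b' x)) → (∀ y → Q (c' y)) → ∀ p → Q p
  cover-elim Q qb qc p with cover p
  ... | inj₁ (x , refl) = qb x
  ... | inj₂ (y , refl) = qc y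

  module Copair {Y : Set} (y1 : X1 → Y) (y2 : X2 → Y) (compat : ∀ z → y1 (b z) ≡ y2 (c z)) where

    copair-on : ∀ {p} → Fiber b' p ⊎ Fiber c' p → Y
    copair-on (inj₁ (x , _)) = y1 x
    copair-on (inj₂ (y , _)) = y2 y

    copair : P → Y
    copair p = copair-on (cover p)

    -- the value does not depend on which side of the cover is used
    copair-on-b' : ∀ x (s : Fiber b' (b' x) ⊎ Fiber c' (b' x)) → copair-on s ≡ y1 x
    copair-on-b' x (inj₁ (x' , eq)) = cong y1 (b'-inj eq)
    copair-on-b' x (inj₂ (y , eq)) with meet x y (sym eq)
    ... | z , refl , refl = sym (compat z)

    copair-on-c' : ∀ y (s : Fiber b' (c' y) ⊎ Fiber c' (c' y)) → copair-on s ≡ y2 y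
    copair-on-c' y (inj₂ (y' , eq)) = cong y2 (c'-inj eq)
    copair-on-c' y (inj₁ (x , eq)) with meet x y eq
    ... | z , refl , refl = compat z

    copair-b' : ∀ x → copair (b' x) ≡ y1 x
    copair-b' x = copair-on-b' x (cover (b' x))

    copair-c' : ∀ y → copair (c' y) ≡ y2 y
    copair-c' y = copair-on-c' y (cover (c' y))

    copair-unique : (u : P → Y) → (∀ x → u (b' x) ≡ y1 x) → (∀ y → u (c' y) ≡ y2 y) →
                    ∀ p → u p ≡ copair p
    copair-unique u ub uc = cover-elim (λ p → u p ≡ copair p)
      (λ x → trans (ub x) (sym (copair-b' x))) (λ y → trans (uc y) (sym (copair-c' y)))

↑ˡ≢↑ʳ : ∀ {m n} (i : Fin m) (j : Fin n) → i ↑ˡ n ≢ m ↑ʳ j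
↑ˡ≢↑ʳ {m} {n} i j eq with trans (sym (splitAt-↑ˡ m i n)) (trans (cong (splitAt m) eq) (splitAt-↑ʳ m n j))
... | ()

-- Given injections κ : Fin k → Fin l (the interface
-- inside the left-hand side) and g : Fin l → Fin n (the match), keep every element
-- of Fin n except the images of Fin l ∖ κ(Fin k).  Together with the inclusion of
-- the kept elements and the induced map `inner` from Fin k, this is the node (or
-- edge) part of the left pushout square of a direct derivation.
module FinComplement {k l n} (κ : Fin k → Fin l) (g : Fin l → Fin n)
  (κ-inj : Injective _≡_ _≡_ κ) (g-inj : Injective _≡_ _≡_ g) where

  Deleted : Fin n → Set
  Deleted v = ∃ λ w → g w ≡ v × ¬ Fiber κ w

  deleted? : ∀ v → Dec (Deleted v)
  deleted? v = any? (λ w → (g w ≟ v) ×-dec ¬? (fiber? κ w))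

  open FinSubset (finSubset n (λ v → ¬ Deleted v) (λ v → ¬? (deleted? v))) public

  inner-kept : ∀ c → ¬ Deleted (g (κ c))
  inner-kept c (w , gw≡ , w∉κ) = w∉κ (c , g-inj (sym gw≡))

  inner : Fin k → Fin size
  inner c = index (g (κ c)) (inner-kept c)

  emb-inner : ∀ c → emb (inner c) ≡ g (κ c)
  emb-inner c = emb-index _ _

  inner-inj : Injective _≡_ _≡_ inner
  inner-inj eq = κ-inj (g-inj (trans (sym (emb-inner _)) (trans (cong emb eq) (emb-inner _))))

  cover : ∀ v → Fiber g v ⊎ Fiber emb v
  cover v with deleted? v
  ... | yes (w , gw≡ , _) = inj₁ (w , gw≡)
  ... | no kept           = inj₂ (index v kept , emb-index v kept)

  meet : ∀ x y → g x ≡ emb y → ∃ λ z → κ z ≡ x × inner z ≡ y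
  meet x y eq with fiber? κ x
  ... | yes (z , refl) = z , refl , emb-inj (trans (emb-inner z) eq)
  ... | no x∉κ         = ⊥-elim (emb-P y (x , eq , x∉κ))

-- Set-level pushout of two injections k : Fin c → Fin d and m : Fin c → Fin r:
-- Fin d extended by the elements of Fin r outside the image of m.
module FinPushout {c d r} (k : Fin c → Fin d) (m : Fin c → Fin r)
  (k-inj : Injective _≡_ _≡_ k) (m-inj : Injective _≡_ _≡_ m) where

  module New = FinSubset (finSubset r (λ w → ¬ Fiber m w) (λ w → ¬? (fiber? m w)))

  size : ℕ
  size = d + New.size

  inl : Fin d → Fin size
  inl x = x ↑ˡ New.size

  inr-on : ∀ w → Dec (Fiber m w) → Fin size
  inr-on w (yes (z , _)) = inl (k z)
  inr-on w (no w-new)    = d ↑ʳ New.index w w-new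

  inr : Fin r → Fin size
  inr w = inr-on w (fiber? m w)

  inr-m : ∀ z → inr (m z) ≡ inl (k z)
  inr-m z with fiber? m (m z)
  ... | yes (z' , eq) = cong (λ z → inl (k z)) (m-inj eq)
  ... | no  mz-new    = ⊥-elim (mz-new (z , refl))

  inr-new : ∀ w (w-new : ¬ Fiber m w) → inr w ≡ d ↑ʳ New.index w w-new
  inr-new w w-new with fiber? m w
  ... | yes w∈m = ⊥-elim (w-new w∈m)
  ... | no  w-new′ = cong (d ↑ʳ_) (New.index-cong refl w-new′ w-new)

  inl-inj : Injective _≡_ _≡_ inl
  inl-inj = ↑ˡ-injective New.size _ _

  inr-inj-on : ∀ w w' (s : Dec (Fiber m w)) (s' : Dec (Fiber m w')) → inr-on w s ≡ inr-on w' s' → w ≡ w'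
  inr-inj-on _ _ (yes (z , refl)) (yes (z' , refl)) eq = cong m (k-inj (inl-inj eq))
  inr-inj-on _ _ (yes _)           (no _)             eq = ⊥-elim (↑ˡ≢↑ʳ _ _ eq)
  inr-inj-on _ _ (no _)            (yes _)            eq = ⊥-elim (↑ˡ≢↑ʳ _ _ (sym eq))
  inr-inj-on w w' (no w-new)       (no w'-new)        eq =
    trans (sym (New.emb-index w w-new))
      (trans (cong New.emb (↑ʳ-injective d _ _ eq)) (New.emb-index w' w'-new))

  inr-inj : Injective _≡_ _≡_ inr
  inr-inj {w} {w'} = inr-inj-on w w' (fiber? m w) (fiber? m w')

  copair : {Y : Set} → (Fin d → Y) → (Fin New.size → Y) → Fin size → Y
  copair f h x = [ f , h ] (splitAt d x)

  copair-inl : {Y : Set} (f : Fin d → Y) (h : Fin New.size → Y) → ∀ x → copair f h (inl x) ≡ f x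
  copair-inl f h x = cong [ f , h ] (splitAt-↑ˡ d x New.size)

  copair-new : {Y : Set} (f : Fin d → Y) (h : Fin New.size → Y) → ∀ j → copair f h (d ↑ʳ j) ≡ h j
  copair-new f h j = cong [ f , h ] (splitAt-↑ʳ d New.size j)

  cover-on : ∀ p s → splitAt d p ≡ s → Fiber inl p ⊎ Fiber inr p
  cover-on p (inj₁ x) eq = inj₁ (x , splitAt⁻¹-↑ˡ eq)
  cover-on p (inj₂ j) eq = inj₂ (New.emb j ,
    trans (inr-new _ (New.emb-P j)) (trans (cong (d ↑ʳ_) (New.index-emb j _)) (splitAt⁻¹-↑ʳ eq)))

  cover : ∀ p → Fiber inl p ⊎ Fiber inr p
  cover p = cover-on p (splitAt d p) refl

  meet-on : ∀ x y (s : Dec (Fiber m y)) → inl x ≡ inr-on y s → ∃ λ z → k z ≡ x × m z ≡ y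
  meet-on x y (yes (z , refl)) eq = z , sym (inl-inj eq) , refl
  meet-on x y (no _)           eq = ⊥-elim (↑ˡ≢↑ʳ _ _ eq)

  meet : ∀ x y → inl x ≡ inr y → ∃ λ z → k z ≡ x × m z ≡ y
  meet x y = meet-on x y (fiber? m y)

-- The two endpoints of an edge, so that source and target are treated uniformly.
data End : Set where
  source target : End

module _ {A : Alphabet} where

  end : End → (G : Graph A) → Fin (nE G) → Fin (nV G)
  end source = src
  end target = tgt

  pres-end : {G H : Graph A} (f : Hom G H) (ε : End) → ∀ e → end ε H (fE f e) ≡ fV f (end ε G e)
  pres-end f source = pres-src f
  pres-end f target = pres-tgt f

  JointlySurjective : {X1 X2 P : Graph A} → Hom X1 P → Hom X2 P → Set
  JointlySurjective b' c' = (∀ v → InImV b' v ⊎ InImV c' v) × (∀ e → InImE b' e ⊎ InImE c' e)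

  MeetAlong : {X0 X1 X2 P : Graph A} → Hom X0 X1 → Hom X0 X2 → Hom X1 P → Hom X2 P → Set
  MeetAlong b c b' c' =
    (∀ x y → fV b' x ≡ fV c' y → ∃ λ z → fV b z ≡ x × fV c z ≡ y) ×
    (∀ x y → fE b' x ≡ fE c' y → ∃ λ z → fE b z ≡ x × fE c z ≡ y)

  -- Graph pushouts are recognised sortwise: a commuting square of injective,
  -- jointly surjective morphisms meeting exactly along X0 is a pushout.
  pushout-recognition : {X0 X1 X2 P : Graph A}
    (b : Hom X0 X1) (c : Hom X0 X2) (b' : Hom X1 P) (c' : Hom X2 P) →
    (b' ∘ₕ b) ≈ₕ (c' ∘ₕ c) → IsInjective b' → IsInjective c' →
    JointlySurjective b' c' → MeetAlong b c b' c' → IsPushout b c b' c'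
  pushout-recognition {X1 = X1} {X2} {P} b c b' c' comm (b'V-inj , b'E-inj) (c'V-inj , c'E-inj)
                      (coverV , coverE) (meetV , meetE) = comm , universal
    where
    module V = SetPushout (fV b) (fV c) (fV b') (fV c') b'V-inj c'V-inj coverV meetV
    module E = SetPushout (fE b) (fE c) (fE b') (fE c') b'E-inj c'E-inj coverE meetE

    universal : ∀ Y (y1 : Hom X1 Y) (y2 : Hom X2 Y) → (y1 ∘ₕ b) ≈ₕ (y2 ∘ₕ c) →
      Σ (Hom P Y) λ u → ((u ∘ₕ b') ≈ₕ y1) × ((u ∘ₕ c') ≈ₕ y2) ×
        (∀ (u' : Hom P Y) → (u' ∘ₕ b') ≈ₕ y1 → (u' ∘ₕ c') ≈ₕ y2 → u' ≈ₕ u)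
    universal Y y1 y2 (compatV , compatE) =
      u , (UV.copair-b' , UE.copair-b') , (UV.copair-c' , UE.copair-c') , unique
      where
      module UV = V.Copair (fV y1) (fV y2) compatV
      module UE = E.Copair (fE y1) (fE y2) compatE

      pres : ∀ ε e → end ε Y (UE.copair e) ≡ UV.copair (end ε P e)
      pres ε = E.cover-elim _
        (λ x → begin
          end ε Y (UE.copair (fE b' x))   ≡⟨ cong (end ε Y) (UE.copair-b' x) ⟩
          end ε Y (fE y1 x)               ≡⟨ pres-end y1 ε x ⟩
          fV y1 (end ε X1 x)              ≡⟨ sym (UV.copair-b' _) ⟩
          UV.copair (fV b' (end ε X1 x))  ≡⟨ cong UV.copair (sym (pres-end b' ε x)) ⟩
          UV.copair (end ε P (fE b' x))   ∎)
        (λ y → begin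
          end ε Y (UE.copair (fE c' y))   ≡⟨ cong (end ε Y) (UE.copair-c' y) ⟩
          end ε Y (fE y2 y)               ≡⟨ pres-end y2 ε y ⟩
          fV y2 (end ε X2 y)              ≡⟨ sym (UV.copair-c' _) ⟩
          UV.copair (fV c' (end ε X2 y))  ≡⟨ cong UV.copair (sym (pres-end c' ε y)) ⟩
          UV.copair (end ε P (fE c' y))   ∎)
        where open ≡-Reasoning

      u : Hom P Y
      u = record
        { fV = UV.copair ; fE = UE.copair ; pres-src = pres source ; pres-tgt = pres target
        ; pres-lV = V.cover-elim _
            (λ x → trans (cong (lV Y) (UV.copair-b' x)) (trans (pres-lV y1 x) (sym (pres-lV b' x))))
            (λ y → trans (cong (lV Y) (UV.copair-c' y)) (trans (pres-lV y2 y) (sym (pres-lV c' y))))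
        ; pres-lE = E.cover-elim _
            (λ x → trans (cong (lE Y) (UE.copair-b' x)) (trans (pres-lE y1 x) (sym (pres-lE b' x))))
            (λ y → trans (cong (lE Y) (UE.copair-c' y)) (trans (pres-lE y2 y) (sym (pres-lE c' y)))) }

      unique : ∀ (u' : Hom P Y) → (u' ∘ₕ b') ≈ₕ y1 → (u' ∘ₕ c') ≈ₕ y2 → u' ≈ₕ u
      unique u' (bV , bE) (cV , cE) = UV.copair-unique (fV u') bV cV , UE.copair-unique (fE u') bE cE

  Applicable : (r : Rule {A}) {G : Graph A} → Hom (L r) G → Set
  Applicable r g = IsInjective g × Dangling r g

  dangling-end : (r : Rule {A}) {G : Graph A} {g : Hom (L r) G} → Dangling r g →
                 ∀ ε e → ¬ InImE g e → ∀ v → ¬ InImV (kl r) v → end ε G e ≢ fV g v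
  dangling-end r dangling source e e∉g v v∉kl = proj₁ (dangling e e∉g v v∉kl)
  dangling-end r dangling target e e∉g v v∉kl = proj₂ (dangling e e∉g v v∉kl)

  -- Left square of a direct derivation: removing g(L ∖ K) from G leaves a graph D
  -- (edges survive with their endpoints by the dangling condition), and
  -- L ← K → D → G is a pushout.
  module PushoutComplement (r : Rule {A}) {G : Graph A} (g : Hom (L r) G)
                           (g-inj : IsInjective g) (dangling : Dangling r g) where

    module V = FinComplement (fV (kl r)) (fV g) (proj₁ (kl-inj r)) (proj₁ g-inj)
    module E = FinComplement (fE (kl r)) (fE g) (proj₂ (kl-inj r)) (proj₂ g-inj)

    -- kept edges have kept endpoints: unmatched edges by the dangling condition,
    -- matched ones because they come from K, whose edges have endpoints in K
    kept-end : ∀ ε e → ¬ E.Deleted e → ¬ V.Deleted (end ε G e)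
    kept-end ε e e-kept (w , gw≡end , w∉kl) with fiber? (fE g) e
    ... | no  e∉g        = dangling-end r {g = g} dangling ε e e∉g w w∉kl (sym gw≡end)
    ... | yes (x , refl) = e-kept (x , refl , x∉kl)
      where
      open ≡-Reasoning
      x∉kl : ¬ Fiber (fE (kl r)) x
      x∉kl (c , refl) = w∉kl (end ε (K r) c , proj₁ g-inj (begin
        fV g (fV (kl r) (end ε (K r) c))  ≡⟨ cong (fV g) (sym (pres-end (kl r) ε c)) ⟩
        fV g (end ε (L r) (fE (kl r) c))  ≡⟨ sym (pres-end g ε _) ⟩
        end ε G (fE g (fE (kl r) c))      ≡⟨ sym gw≡end ⟩
        fV g w                            ∎))

    endD : End → Fin E.size → Fin V.size
    endD ε e = V.index (end ε G (E.emb e)) (kept-end ε _ (E.emb-P e))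

    D : Graph A
    D = record { nV = V.size ; nE = E.size ; src = endD source ; tgt = endD target
               ; lV = λ v → lV G (V.emb v) ; lE = λ e → lE G (E.emb e) }

    end-D : ∀ ε e → end ε D e ≡ endD ε e
    end-D source e = refl
    end-D target e = refl

    d-end : ∀ ε e → end ε G (E.emb e) ≡ V.emb (end ε D e)
    d-end ε e = trans (sym (V.emb-index _ _)) (cong V.emb (sym (end-D ε e)))

    d : Hom D G
    d = record { fV = V.emb ; fE = E.emb ; pres-src = d-end source ; pres-tgt = d-end target
               ; pres-lV = λ _ → refl ; pres-lE = λ _ → refl }

    k-end : ∀ ε c → end ε D (E.inner c) ≡ V.inner (end ε (K r) c)
    k-end ε c = trans (end-D ε _) (V.index-cong (begin
      end ε G (E.emb (E.inner c))       ≡⟨ cong (end ε G) (E.emb-inner c) ⟩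
      end ε G (fE g (fE (kl r) c))      ≡⟨ pres-end g ε _ ⟩
      fV g (end ε (L r) (fE (kl r) c))  ≡⟨ cong (fV g) (pres-end (kl r) ε c) ⟩
      fV g (fV (kl r) (end ε (K r) c))  ∎) _ _)
      where open ≡-Reasoning

    k : Hom (K r) D
    k = record
      { fV = V.inner ; fE = E.inner ; pres-src = k-end source ; pres-tgt = k-end target
      ; pres-lV = λ c → trans (cong (lV G) (V.emb-inner c)) (trans (pres-lV g _) (pres-lV (kl r) c))
      ; pres-lE = λ c → trans (cong (lE G) (E.emb-inner c)) (trans (pres-lE g _) (pres-lE (kl r) c)) }

    k-inj : IsInjective k
    k-inj = V.inner-inj , E.inner-inj

    square : IsPushout (kl r) k g d
    square = pushout-recognition (kl r) k g d
      ((λ c → sym (V.emb-inner c)) , (λ c → sym (E.emb-inner c)))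
      g-inj (V.emb-inj , E.emb-inj) (V.cover , E.cover) (V.meet , E.meet)

  -- Right square of a direct derivation: the pushout of two injective morphisms
  -- D ← K → R is D together with a fresh copy of R ∖ m(K).
  module InjectivePushout {K D R : Graph A} (k : Hom K D) (m : Hom K R)
                          (k-inj : IsInjective k) (m-inj : IsInjective m) where

    module V = FinPushout (fV k) (fV m) (proj₁ k-inj) (proj₁ m-inj)
    module E = FinPushout (fE k) (fE m) (proj₂ k-inj) (proj₂ m-inj)

    endH : End → Fin E.size → Fin V.size
    endH ε = E.copair (λ i → V.inl (end ε D i)) (λ j → V.inr (end ε R (E.New.emb j)))

    H : Graph A
    H = record { nV = V.size ; nE = E.size ; src = endH source ; tgt = endH target
               ; lV = V.copair (lV D) (λ j → lV R (V.New.emb j))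
               ; lE = E.copair (lE D) (λ j → lE R (E.New.emb j)) }

    end-H : ∀ ε e → end ε H e ≡ endH ε e
    end-H source e = refl
    end-H target e = refl

    inl : Hom D H
    inl = record
      { fV = V.inl ; fE = E.inl ; pres-src = inl-end source ; pres-tgt = inl-end target
      ; pres-lV = V.copair-inl _ _ ; pres-lE = E.copair-inl _ _ }
      where
      inl-end : ∀ ε i → end ε H (E.inl i) ≡ V.inl (end ε D i)
      inl-end ε i = trans (end-H ε _) (E.copair-inl _ _ i)

    inr-end-on : ∀ ε w → Dec (InImE m w) → end ε H (E.inr w) ≡ V.inr (end ε R w)
    inr-end-on ε _ (yes (c , refl)) = begin
      end ε H (E.inr (fE m c))  ≡⟨ cong (end ε H) (E.inr-m c) ⟩
      end ε H (E.inl (fE k c))  ≡⟨ pres-end inl ε _ ⟩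
      V.inl (end ε D (fE k c))  ≡⟨ cong V.inl (pres-end k ε c) ⟩
      V.inl (fV k (end ε K c))  ≡⟨ sym (V.inr-m _) ⟩
      V.inr (fV m (end ε K c))  ≡⟨ cong V.inr (sym (pres-end m ε c)) ⟩
      V.inr (end ε R (fE m c))  ∎
      where open ≡-Reasoning
    inr-end-on ε w (no w-new) = begin
      end ε H (E.inr w)                                 ≡⟨ cong (end ε H) (E.inr-new w w-new) ⟩
      end ε H (_ ↑ʳ E.New.index w w-new)                ≡⟨ end-H ε _ ⟩
      endH ε (_ ↑ʳ E.New.index w w-new)                 ≡⟨ E.copair-new _ _ _ ⟩
      V.inr (end ε R (E.New.emb (E.New.index w w-new))) ≡⟨ cong (λ x → V.inr (end ε R x)) (E.New.emb-index w w-new) ⟩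
      V.inr (end ε R w)                                 ∎
      where open ≡-Reasoning

    inr-lV-on : ∀ w → Dec (InImV m w) → lV H (V.inr w) ≡ lV R w
    inr-lV-on _ (yes (c , refl)) = trans (cong (lV H) (V.inr-m c))
      (trans (V.copair-inl _ _ _) (trans (pres-lV k c) (sym (pres-lV m c))))
    inr-lV-on w (no w-new) = trans (cong (lV H) (V.inr-new w w-new))
      (trans (V.copair-new _ _ _) (cong (lV R) (V.New.emb-index w w-new)))

    inr-lE-on : ∀ w → Dec (InImE m w) → lE H (E.inr w) ≡ lE R w
    inr-lE-on _ (yes (c , refl)) = trans (cong (lE H) (E.inr-m c))
      (trans (E.copair-inl _ _ _) (trans (pres-lE k c) (sym (pres-lE m c))))
    inr-lE-on w (no w-new) = trans (cong (lE H) (E.inr-new w w-new))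
      (trans (E.copair-new _ _ _) (cong (lE R) (E.New.emb-index w w-new)))

    inr : Hom R H
    inr = record
      { fV = V.inr ; fE = E.inr
      ; pres-src = λ w → inr-end-on source w (fiber? (fE m) w)
      ; pres-tgt = λ w → inr-end-on target w (fiber? (fE m) w)
      ; pres-lV = λ w → inr-lV-on w (fiber? (fV m) w)
      ; pres-lE = λ w → inr-lE-on w (fiber? (fE m) w) }

    square : IsPushout k m inl inr
    square = pushout-recognition k m inl inr
      ((λ c → sym (V.inr-m c)) , (λ c → sym (E.inr-m c)))
      (V.inl-inj , E.inl-inj) (V.inr-inj , E.inr-inj) (V.cover , E.cover) (V.meet , E.meet)

  derive : (r : Rule {A}) {G : Graph A} (g : Hom (L r) G) → Applicable r g → Σ (Graph A) (Derivation r g)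
  derive r g (g-inj , dangling) = Right.H , record
    { g-inj = g-inj ; dangling = dangling ; D = Left.D ; k = Left.k ; d = Left.d
    ; h = Right.inr ; e = Right.inl ; pushoutL = Left.square ; pushoutR = Right.square }
    where
    module Left  = PushoutComplement r g g-inj dangling
    module Right = InjectivePushout Left.k (kr r) Left.k-inj (kr-inj r)

  ≈ₕ? : {G H : Graph A} (f f' : Hom G H) → Dec (f ≈ₕ f')
  ≈ₕ? f f' = all? (λ v → fV f v ≟ fV f' v) ×-dec all? (λ e → fE f e ≟ fE f' e)

  applicable? : (r : Rule {A}) {G : Graph A} (g : Hom (L r) G) → Dec (Applicable r g)
  applicable? r {G} g = (injective? (fV g) ×-dec injective? (fE g)) ×-dec
    all? λ e → ¬? (fiber? (fE g) e) →-dec all? λ v → ¬? (fiber? (fV (kl r)) v) →-dec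
      (¬? (src G e ≟ fV g v) ×-dec ¬? (tgt G e ≟ fV g v))

  module IsoTransfer {G G' : Graph A} (φ : Iso G G') where

    φV-inj : Injective _≡_ _≡_ (fV (to φ))
    φV-inj {x} {y} eq = trans (sym (proj₁ (from∘to φ) x)) (trans (cong (fV (from φ)) eq) (proj₁ (from∘to φ) y))

    φE-inj : Injective _≡_ _≡_ (fE (to φ))
    φE-inj {x} {y} eq = trans (sym (proj₂ (from∘to φ) x)) (trans (cong (fE (from φ)) eq) (proj₂ (from∘to φ) y))

    module Along {L : Graph A} (g : Hom L G) (g' : Hom L G') (g≈ : (to φ ∘ₕ g) ≈ₕ g') where

      imV-to : ∀ {v} → InImV g v → InImV g' (fV (to φ) v)
      imV-to (x , refl) = x , sym (proj₁ g≈ x)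

      imE-to : ∀ {e} → InImE g e → InImE g' (fE (to φ) e)
      imE-to (x , refl) = x , sym (proj₂ g≈ x)

      imV-from : ∀ {v} → InImV g' (fV (to φ) v) → InImV g v
      imV-from (x , eq) = x , φV-inj (trans (proj₁ g≈ x) eq)

      imE-from : ∀ {e} → InImE g' (fE (to φ) e) → InImE g e
      imE-from (x , eq) = x , φE-inj (trans (proj₂ g≈ x) eq)

      injective : IsInjective g → IsInjective g'
      injective (gV-inj , gE-inj) =
        (λ eq → gV-inj (φV-inj (trans (proj₁ g≈ _) (trans eq (sym (proj₁ g≈ _)))))) ,
        (λ eq → gE-inj (φE-inj (trans (proj₂ g≈ _) (trans eq (sym (proj₂ g≈ _))))))

    along-∘ : {K L : Graph A} {g : Hom L G} {g' : Hom L G'} (κ : Hom K L) →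
              (to φ ∘ₕ g) ≈ₕ g' → (to φ ∘ₕ (g ∘ₕ κ)) ≈ₕ (g' ∘ₕ κ)
    along-∘ κ (gV≈ , gE≈) = (λ x → gV≈ (fV κ x)) , (λ x → gE≈ (fE κ x))

    applicable : (r : Rule {A}) {g : Hom (L r) G} {g' : Hom (L r) G'} →
                 (to φ ∘ₕ g) ≈ₕ g' → Applicable r g → Applicable r g'
    applicable r {g} {g'} g≈ (g-inj , dangling) = M.injective g-inj , dangling′
      where
      module M = Along g g' g≈
      ψ : Hom G' G
      ψ = from φ
      -- an unmatched edge of G' at an unmatched node would come from one in G
      dangling′ : Dangling r g'
      dangling′ e' e'∉g' v v∉kl = at source , at target
        where
        open ≡-Reasoning
        at : ∀ ε → end ε G' e' ≢ fV g' v
        at ε eq = dangling-end r {g = g} dangling ε (fE ψ e')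
          (λ e∈g → e'∉g' (subst (InImE g') (proj₂ (to∘from φ) e') (M.imE-to e∈g))) v v∉kl
          (begin
            end ε G (fE ψ e')          ≡⟨ pres-end ψ ε e' ⟩
            fV ψ (end ε G' e')         ≡⟨ cong (fV ψ) eq ⟩
            fV ψ (fV g' v)             ≡⟨ cong (fV ψ) (sym (proj₁ g≈ v)) ⟩
            fV ψ (fV (to φ) (fV g v))  ≡⟨ proj₁ (from∘to φ) _ ⟩
            fV g v                     ∎)

    subgraph : SubgraphOf G' G
    subgraph = from φ , (λ eq → trans (sym (proj₁ (to∘from φ) _)) (trans (cong (fV (to φ)) eq) (proj₁ (to∘from φ) _)))
                      , (λ eq → trans (sym (proj₂ (to∘from φ) _)) (trans (cong (fE (to φ)) eq) (proj₂ (to∘from φ) _)))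

    agree-along : {I : Set} (Ls : I → Graph A) {i j : I} (eq : i ≡ j)
      {g1 : Hom (Ls i) G} {g2 : Hom (Ls j) G} {g1' : Hom (Ls i) G'} {g2' : Hom (Ls j) G'} →
      (to φ ∘ₕ g1) ≈ₕ g1' → (to φ ∘ₕ g2) ≈ₕ g2' →
      subst (λ i → Hom (Ls i) G') eq g1' ≈ₕ g2' → subst (λ i → Hom (Ls i) G) eq g1 ≈ₕ g2
    agree-along Ls refl (g1V≈ , g1E≈) (g2V≈ , g2E≈) (V≈ , E≈) =
      (λ v → φV-inj (trans (g1V≈ v) (trans (V≈ v) (sym (g2V≈ v))))) ,
      (λ e → φE-inj (trans (g1E≈ e) (trans (E≈ e) (sym (g2E≈ e)))))

bind-Any : {X Y : Set} {Q : X → Set} {P : Y → Set} {f : X → List Y} {xs : List X} →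
           Any Q xs → (∀ {x} → Q x → Any P (f x)) → Any P (concatMap f xs)
bind-Any {f = f} q h = Any.concatMap⁺ f (Any.map h q)

bind-∈ : {X Y : Set} {P : Y → Set} {f : X → List Y} {x : X} {xs : List X} →
         x ∈ xs → Any P (f x) → Any P (concatMap f xs)
bind-∈ x∈xs h = bind-Any x∈xs λ { refl → h }

when : {P X : Set} → Dec P → (P → List X) → List X
when (yes p) f = f p
when (no _)  f = []

when-Any : {P X : Set} {Q : X → Set} (d : Dec P) (f : P → List X) → P →
           (∀ p → Any Q (f p)) → Any Q (when d f)
when-Any (yes p) f _ h = h p
when-Any (no ¬p) f p h = ⊥-elim (¬p p)

-- All maps Fin n → Fin k, listed up to pointwise equality.
functions : ∀ n k → List (Fin n → Fin k)
functions zero    k = (λ ()) ∷ []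
functions (suc n) k = concatMap (λ a → Data.List.map (a Vector.∷_) (functions n k)) (allFin k)

functions-complete : ∀ {n k} (f : Fin n → Fin k) → Any (f ≗_) (functions n k)
functions-complete {zero}  f = here (λ ())
functions-complete {suc n} f =
  bind-Any (∈-allFin (f zero)) λ { refl →
  Any.map⁺ (Any.map (λ f∘suc≗h → λ { zero → refl ; (suc i) → f∘suc≗h i })
                    (functions-complete (λ i → f (suc i)))) }

select : {X : Set} {Q : X → Set} (xs : List X) → All (λ x → Dec (Q x)) xs → List X
select []       []           = []
select (x ∷ xs) (yes _ ∷ ds) = x ∷ select xs ds
select (x ∷ xs) (no  _ ∷ ds) = select xs ds

select-sound : {X : Set} {P Q : X → Set} (xs : List X) (ds : All (λ x → Dec (Q x)) xs) →
               All P xs → All (λ x → P x × Q x) (select xs ds)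
select-sound []       []              []         = []
select-sound (x ∷ xs) (yes qx ∷ ds) (px ∷ pxs) = (px , qx) ∷ select-sound xs ds pxs
select-sound (x ∷ xs) (no  _  ∷ ds) (_  ∷ pxs) = select-sound xs ds pxs

select-complete : {X : Set} {Q R : X → Set} → (∀ {x} → R x → Q x) →
                  (xs : List X) (ds : All (λ x → Dec (Q x)) xs) → Any R xs → Any R (select xs ds)
select-complete R⇒Q (x ∷ xs) (yes _  ∷ ds) (here rx)  = here rx
select-complete R⇒Q (x ∷ xs) (no ¬qx ∷ ds) (here rx)  = ⊥-elim (¬qx (R⇒Q rx))
select-complete R⇒Q (x ∷ xs) (yes _  ∷ ds) (there r) = there (select-complete R⇒Q xs ds r)
select-complete R⇒Q (x ∷ xs) (no  _  ∷ ds) (there r) = select-complete R⇒Q xs ds r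

¬¬-decided : {X : Set} {Q : X → Set} (xs : List X) → ¬ ¬ All (λ x → Dec (Q x)) xs
¬¬-decided []       k = k []
¬¬-decided (x ∷ xs) k = ¬¬-excluded-middle λ dx → ¬¬-decided xs λ ds → k (dx ∷ ds)

module _ {A : Alphabet} where

  record Structure (nv ne : ℕ) : Set where
    constructor structure
    field
      s t : Fin ne → Fin nv
      lv  : Fin nv → Fin (Alphabet.kV A)
      le  : Fin ne → Fin (Alphabet.kE A)

  graphOf : ∀ {nv ne} → Structure nv ne → Graph A
  graphOf {nv} {ne} S = record { nV = nv ; nE = ne ; src = s ; tgt = t ; lV = lv ; lE = le }
    where open Structure S

  structures : ∀ nv ne → List (Structure nv ne)
  structures nv ne = do
    s  ← functions ne nv
    t  ← functions ne nv
    lv ← functions nv _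
    le ← functions ne _
    structure s t lv le ∷ []

  Agrees : (G : Graph A) → Structure (nV G) (nE G) → Set
  Agrees G S = src G ≗ s × tgt G ≗ t × lV G ≗ lv × lE G ≗ le
    where open Structure S

  structures-complete : (G : Graph A) → Any (Agrees G) (structures (nV G) (nE G))
  structures-complete G =
    bind-Any (functions-complete (src G)) λ src≗ → bind-Any (functions-complete (tgt G)) λ tgt≗ →
    bind-Any (functions-complete (lV G))  λ lV≗  → bind-Any (functions-complete (lE G))  λ lE≗  →
    here (src≗ , tgt≗ , lV≗ , lE≗)

  agrees-iso : (G : Graph A) (S : Structure (nV G) (nE G)) → Agrees G S → Iso G (graphOf S)
  agrees-iso G S (src≗ , tgt≗ , lV≗ , lE≗) = record
    { to   = record { fV = λ v → v ; fE = λ e → e ; pres-src = λ e → sym (src≗ e) ; pres-tgt = λ e → sym (tgt≗ e)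
                    ; pres-lV = λ v → sym (lV≗ v) ; pres-lE = λ e → sym (lE≗ e) }
    ; from = record { fV = λ v → v ; fE = λ e → e ; pres-src = src≗ ; pres-tgt = tgt≗
                    ; pres-lV = lV≗ ; pres-lE = lE≗ }
    ; from∘to = (λ _ → refl) , (λ _ → refl)
    ; to∘from = (λ _ → refl) , (λ _ → refl) }

  HomLaws : (L G : Graph A) → (Fin (nV L) → Fin (nV G)) → (Fin (nE L) → Fin (nE G)) → Set
  HomLaws L G fv fe = (∀ e → src G (fe e) ≡ fv (src L e)) × (∀ e → tgt G (fe e) ≡ fv (tgt L e)) ×
                      (∀ v → lV G (fv v) ≡ lV L v) × (∀ e → lE G (fe e) ≡ lE L e)

  homLaws? : (L G : Graph A) → ∀ fv fe → Dec (HomLaws L G fv fe)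
  homLaws? L G fv fe = all? (λ e → src G (fe e) ≟ fv (src L e)) ×-dec all? (λ e → tgt G (fe e) ≟ fv (tgt L e)) ×-dec
                       all? (λ v → lV G (fv v) ≟ lV L v) ×-dec all? (λ e → lE G (fe e) ≟ lE L e)

  homOf : {L G : Graph A} → ∀ fv fe → HomLaws L G fv fe → Hom L G
  homOf fv fe (s , t , lv , le) = record { fV = fv ; fE = fe ; pres-src = s ; pres-tgt = t ; pres-lV = lv ; pres-lE = le }

  homs : (L G : Graph A) → List (Hom L G)
  homs L G = do
    fv ← functions (nV L) (nV G)
    fe ← functions (nE L) (nE G)
    when (homLaws? L G fv fe) λ laws → homOf fv fe laws ∷ []

  homs-complete : {L G : Graph A} (h : Hom L G) → Any (h ≈ₕ_) (homs L G)
  homs-complete {L} {G} h =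
    bind-Any (functions-complete (fV h)) λ {fv} fV≗ → bind-Any (functions-complete (fE h)) λ {fe} fE≗ →
    when-Any (homLaws? L G fv fe) _ (laws fv fe fV≗ fE≗) (λ _ → here (fV≗ , fE≗))
    where
    laws : ∀ fv fe → fV h ≗ fv → fE h ≗ fe → HomLaws L G fv fe
    laws fv fe fV≗ fE≗ =
      (λ e → trans (cong (src G) (sym (fE≗ e))) (trans (pres-src h e) (fV≗ _))) ,
      (λ e → trans (cong (tgt G) (sym (fE≗ e))) (trans (pres-tgt h e) (fV≗ _))) ,
      (λ v → trans (cong (lV G) (sym (fV≗ v))) (pres-lV h v)) ,
      (λ e → trans (cong (lE G) (sym (fE≗ e))) (pres-lE h e))

  module _ (T : GTS {A}) where

    critical? : (p : DerivPair T) → Dec (IsCriticalPair T p)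
    critical? p = covering? ×-dec ¬? independent? ×-dec distinct?
      where
      open DerivPair p
      covering? : Dec (JointlyCovering T p)
      covering? = all? (λ v → fiber? (fV g1) v ⊎-dec fiber? (fV g2) v) ×-dec
                  all? (λ e → fiber? (fE g1) e ⊎-dec fiber? (fE g2) e)
      independent? : Dec (ParallelIndependent T p)
      independent? =
        all? (λ v → fiber? (fV g1) v →-dec fiber? (fV g2) v →-dec
          (fiber? (fV (g1 ∘ₕ kl (rules T i1))) v ×-dec fiber? (fV (g2 ∘ₕ kl (rules T i2))) v)) ×-dec
        all? (λ e → fiber? (fE g1) e →-dec fiber? (fE g2) e →-dec
          (fiber? (fE (g1 ∘ₕ kl (rules T i1))) e ×-dec fiber? (fE (g2 ∘ₕ kl (rules T i2))) e))
      -- when the rules agree, all proofs of that equality coincide (Fin has decidable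
      -- equality), so it suffices to test the matches along one of them
      distinct? : Dec (DistinctIfSameRule T p)
      distinct? with i1 ≟ i2
      ... | no  i1≢i2 = yes (λ eq → ⊥-elim (i1≢i2 eq))
      ... | yes eq = map′
        (λ g1≉g2 eq′ → subst (λ e → ¬ (subst (λ i → Hom (L (rules T i)) G) e g1 ≈ₕ g2))
                             (Fin-UIP eq eq′) g1≉g2)
        (λ distinct → distinct eq)
        (¬? (≈ₕ? (subst (λ i → Hom (L (rules T i)) G) eq g1) g2))
        where open UIP.Decidable⇒UIP _≟_ renaming (≡-irrelevant to Fin-UIP)

    critical-iso : ∀ (p q : DerivPair T) → IsoPair T p q → IsCriticalPair T p → IsCriticalPair T q
    critical-iso p q (φ , refl , refl , g1≈ , g2≈) ((coverV , coverE) , dependent , distinct) =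
      (coverV′ , coverE′) , dependent′ , distinct′
      where
      open IsoTransfer φ
      module P = DerivPair p
      module Q = DerivPair q
      module M1 = Along P.g1 Q.g1 g1≈
      module M2 = Along P.g2 Q.g2 g2≈
      module K1 = Along (P.g1 ∘ₕ kl (rules T P.i1)) (Q.g1 ∘ₕ kl (rules T P.i1)) (along-∘ {g = P.g1} {Q.g1} (kl (rules T P.i1)) g1≈)
      module K2 = Along (P.g2 ∘ₕ kl (rules T P.i2)) (Q.g2 ∘ₕ kl (rules T P.i2)) (along-∘ {g = P.g2} {Q.g2} (kl (rules T P.i2)) g2≈)
      coverV′ : ∀ v → InImV Q.g1 v ⊎ InImV Q.g2 v
      coverV′ v = subst (λ v → InImV Q.g1 v ⊎ InImV Q.g2 v) (proj₁ (to∘from φ) v)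
        (Data.Sum.map M1.imV-to M2.imV-to (coverV (fV (from φ) v)))
      coverE′ : ∀ e → InImE Q.g1 e ⊎ InImE Q.g2 e
      coverE′ e = subst (λ e → InImE Q.g1 e ⊎ InImE Q.g2 e) (proj₂ (to∘from φ) e)
        (Data.Sum.map M1.imE-to M2.imE-to (coverE (fE (from φ) e)))
      dependent′ : ¬ ParallelIndependent T q
      dependent′ (indepV , indepE) = dependent
        ( (λ v a b → Data.Product.map K1.imV-from K2.imV-from (indepV (fV (to φ) v) (M1.imV-to a) (M2.imV-to b)))
        , (λ e a b → Data.Product.map K1.imE-from K2.imE-from (indepE (fE (to φ) e) (M1.imE-to a) (M2.imE-to b))) )
      distinct′ : DistinctIfSameRule T q
      distinct′ eq q-agree = distinct eq (agree-along (λ i → L (rules T i)) eq {P.g1} {P.g2} {Q.g1} {Q.g2} g1≈ g2≈ q-agree)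

    pairOf : (G : Graph A) {i1 i2 : Fin (nR T)} (g1 : Hom (L (rules T i1)) G) (g2 : Hom (L (rules T i2)) G) →
             Applicable (rules T i1) g1 → Applicable (rules T i2) g2 → DerivPair T
    pairOf G {i1} {i2} g1 g2 a1 a2 = record
      { G = G ; i1 = i1 ; i2 = i2 ; g1 = g1 ; g2 = g2
      ; H1 = proj₁ (derive (rules T i1) g1 a1) ; H2 = proj₁ (derive (rules T i2) g2 a2)
      ; der1 = proj₂ (derive (rules T i1) g1 a1) ; der2 = proj₂ (derive (rules T i2) g2 a2) }

    pairsAt : (G : Graph A) {i1 i2 : Fin (nR T)} (g1 : Hom (L (rules T i1)) G) (g2 : Hom (L (rules T i2)) G) →
              List (DerivPair T)
    pairsAt G {i1} {i2} g1 g2 = when (applicable? (rules T i1) g1 ×-dec applicable? (rules T i2) g2)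
      λ (a1 , a2) → pairOf G g1 g2 a1 a2 ∷ []

    pairsAt-complete : (G : Graph A) {i1 i2 : Fin (nR T)} (g1 : Hom (L (rules T i1)) G) (g2 : Hom (L (rules T i2)) G) →
      Applicable (rules T i1) g1 → Applicable (rules T i2) g2 →
      {Q : DerivPair T → Set} → (∀ a1 a2 → Q (pairOf G g1 g2 a1 a2)) → Any Q (pairsAt G g1 g2)
    pairsAt-complete G {i1} {i2} g1 g2 a1 a2 q =
      when-Any (applicable? (rules T i1) g1 ×-dec applicable? (rules T i2) g2) _ (a1 , a2) (λ (a1 , a2) → here (q a1 a2))

    -- The exhaustive lists below are used only through their completeness lemmas;
    -- they are kept opaque so that type checking never unfolds them.
    opaque
      pairsOfSize : (i1 i2 : Fin (nR T)) (nv ne : ℕ) → List (DerivPair T)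
      pairsOfSize i1 i2 nv ne = do
        S  ← structures nv ne
        g1 ← homs (L (rules T i1)) (graphOf S)
        g2 ← homs (L (rules T i2)) (graphOf S)
        pairsAt (graphOf S) g1 g2

      pairsOfSize-complete : (p : DerivPair T) →
        Any (IsoPair T p) (pairsOfSize (DerivPair.i1 p) (DerivPair.i2 p) (nV (DerivPair.G p)) (nE (DerivPair.G p)))
      pairsOfSize-complete p =
        bind-Any (structures-complete G) λ {S} agrees → let φ = agrees-iso G S agrees in
        bind-Any (homs-complete (to φ ∘ₕ g1)) λ {g1'} g1≈ →
        bind-Any (homs-complete (to φ ∘ₕ g2)) λ {g2'} g2≈ →
        pairsAt-complete (graphOf S) g1' g2'
          (IsoTransfer.applicable φ (rules T i1) {g1} {g1'} g1≈ (Derivation.g-inj der1 , Derivation.dangling der1))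
          (IsoTransfer.applicable φ (rules T i2) {g2} {g2'} g2≈ (Derivation.g-inj der2 , Derivation.dangling der2))
          (λ _ _ → φ , refl , refl , g1≈ , g2≈)
        where open DerivPair p

    opaque
      -- A critical pair is covered by its two left-hand sides, which bounds its size;
      -- so it suffices to list the pairs up to that size.
      candidates : List (DerivPair T)
      candidates = do
        i1 ← allFin (nR T)
        i2 ← allFin (nR T)
        nv ← upTo (suc (nV (L (rules T i1)) + nV (L (rules T i2))))
        ne ← upTo (suc (nE (L (rules T i1)) + nE (L (rules T i2))))
        pairsOfSize i1 i2 nv ne

      candidates-complete : (p : DerivPair T) → IsCriticalPair T p → Any (IsoPair T p) candidates
      candidates-complete p ((coverV , coverE) , _) =
        bind-∈ (∈-allFin i1) (bind-∈ (∈-allFin i2)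
          (bind-∈ (∈-upTo⁺ nodes-bound) (bind-∈ (∈-upTo⁺ edges-bound) (pairsOfSize-complete p))))
        where
        open DerivPair p
        nodes-bound : nV G < suc (nV (L (rules T i1)) + nV (L (rules T i2)))
        nodes-bound = s≤s (covered⇒≤ (fV g1) (fV g2) coverV)
        edges-bound : nE G < suc (nE (L (rules T i1)) + nE (L (rules T i2)))
        edges-bound = s≤s (covered⇒≤ (fE g1) (fE g2) coverE)

    criticalPairs : List (DerivPair T)
    criticalPairs = filter (critical?) candidates

    criticalPairs-critical : All (IsCriticalPair T) criticalPairs
    criticalPairs-critical = All.all-filter (critical?) candidates

    criticalPairs-complete : (p : DerivPair T) → IsCriticalPair T p → Any (IsoPair T p) criticalPairs
    criticalPairs-complete p crit =
      [ (λ listed → listed) , (λ ¬crit → ⊥-elim (¬crit (critical-iso p (Any.lookup found) (Any.lookup-result found) crit))) ]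
        (Any.filter⁺ (critical?) found)
      where
      found : Any (IsoPair T p) candidates
      found = candidates-complete p crit

    closure-iso : (D : Graph A → Set) (p q : DerivPair T) → IsoPair T p q →
                  Closure D (DerivPair.G p) → Closure D (DerivPair.G q)
    closure-iso D p q (φ , _) closed = sub closed (IsoTransfer.subgraph φ)

    nonGarbage : (D : Graph A → Set) → All (λ p → Dec (Closure D (DerivPair.G p))) criticalPairs →
                 Σ (List (DerivPair T)) λ xs → EnumeratesUpToIso T (NonGarbageCP T D) xs
    nonGarbage D decided =
      select criticalPairs decided ,
      select-sound criticalPairs decided criticalPairs-critical ,
      λ p (crit , closed) → select-complete (λ {q} p≅q → closure-iso D p q p≅q closed)
                              criticalPairs decided (criticalPairs-complete p crit)

mainTheorem15 : (A : Alphabet) (T : GTS {A}) (D : Graph A → Set) →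
    (Σ (List (DerivPair T)) λ xs →
       All (IsCriticalPair T) xs ×
       (∀ p → NonGarbageCP T D p → Any (IsoPair T p) xs)) ×
    ¬ ¬ (Σ (List (DerivPair T)) λ xs → EnumeratesUpToIso T (NonGarbageCP T D) xs) ×
    ((∀ (G : Graph A) → Dec (Closure D G)) →
       Σ (List (DerivPair T)) λ xs → EnumeratesUpToIso T (NonGarbageCP T D) xs)
mainTheorem15 A T D =
  (criticalPairs T , criticalPairs-critical T , λ p (crit , _) → criticalPairs-complete T p crit) ,
  (λ noEnumeration → ¬¬-decided (criticalPairs T) λ decided → noEnumeration (nonGarbage T D decided)) ,
  (λ closure? → nonGarbage T D (All.universal (λ p → closure? (DerivPair.G p)) (criticalPairs T)))
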